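{- Let $\mathcal{C} = \operatorname{Av}(312, 123)$ and let $\pi, \tau \in \mathcal{C}$. Then $\operatorname{Av}_{\mathcal{C}}(\pi)$ and $\operatorname{Av}_{\mathcal{C}}(\tau)$ are Wilf-equivalent if and only if $|\pi| = |\tau|$ and either both or neither of $\pi$ and $\tau$ is strictly decreasing.
   Context: Permutations are written in one-line notation. For permutations $\pi,\sigma$, $\pi \preceq \sigma$ ($\pi$ is involved in $\sigma$) if $\sigma$ has a subsequence with the same length as $\pi$ whose entries are in the same relative order as those of $\pi$; otherwise $\sigma$ avoids $\pi$. $\operatorname{Av}(X)$ is the set of all permutations avoiding every permutation in $X$. For a class $\mathcal{C}$ and $\pi\in\mathcal{C}$, $\operatorname{Av}_{\mathcal{C}}(\pi) = \mathcal{C} \cap \operatorname{Av}(\pi)$. Two permutation classes are Wilf-equivalent if, for every $n\ge 0$, they contain the same number of permutations of size $n$. -}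

module Defs where

open import Data.Nat using (ℕ)
open import Data.Fin using (Fin; _<_)
open import Data.Vec using (Vec; lookup; _∷_; [])
open import Data.List using (List; length)
open import Data.List.Membership.Propositional using (_∈_)
open import Data.List.Relation.Unary.Unique.Propositional using (Unique)
open import Data.Product using (Σ; _×_; ∃; ∃-syntax)
open import Function.Bundles using (_⇔_)
open import Relation.Binary.PropositionalEquality using (_≡_)
open import Relation.Nullary using (¬_)

-- One-line notation: a word of length n over {0,…,n-1} (0-based values).
Word : ℕ → Set
Word n = Vec (Fin n) n

IsPerm : ∀ {n} → Word n → Set
IsPerm {n} w = ∀ (i j : Fin n) → lookup w i ≡ lookup w j → i ≡ j

record Perm : Set where
  constructor mkPerm
  field
    size   : ℕ
    word   : Word size
    isPerm : IsPerm word
open Perm public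

_≼_ : ∀ {k n} → Word k → Word n → Set
_≼_ {k} {n} p s =
  Σ (Fin k → Fin n) λ e →
    (∀ i j → i < j → e i < e j) ×
    (∀ i j → (lookup p i < lookup p j) ⇔ (lookup s (e i) < lookup s (e j)))

Avoids : ∀ {n} → Word n → Perm → Set
Avoids s π = ¬ (word π ≼ s)

-- Pattern permutations 123 and 312 (0-based: 012 and 201).
p123 : Word 3
p123 = Fin.zero ∷ Fin.suc Fin.zero ∷ Fin.suc (Fin.suc Fin.zero) ∷ []
  where import Data.Fin as Fin
p312 : Word 3
p312 = Fin.suc (Fin.suc Fin.zero) ∷ Fin.zero ∷ Fin.suc Fin.zero ∷ []
  where import Data.Fin as Fin

Class : Set₁
Class = ∀ {n} → Word n → Set

InC : Class
InC s = IsPerm s × ¬ (p312 ≼ s) × ¬ (p123 ≼ s)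

AvC : Perm → Class
AvC π s = InC s × ¬ (word π ≼ s)

Enumerates : Class → (n : ℕ) → List (Word n) → Set
Enumerates X n L = Unique L × (∀ (w : Word n) → (w ∈ L ⇔ X w))

WilfEquivalent : Class → Class → Set
WilfEquivalent X Y =
  ∀ (n : ℕ) (L M : List (Word n)) →
    Enumerates X n L → Enumerates Y n M → length L ≡ length M

StrictlyDecreasing : Perm → Set
StrictlyDecreasing π = ∀ (i j : Fin (size π)) → i < j → lookup (word π) j < lookup (word π) i

_∈C : Perm → Set
π ∈C = InC (word π)

-- Every σ in 𝒞 = Av(312, 123) is a concatenation of three decreasing runs, of lengths m, h and l,
-- carrying the middle, the highest and the lowest values; σ is determined by (m, h), and every
-- such pair occurs. If π ∈ 𝒞 is not decreasing, its first two runs are non-empty, and σ contains π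
-- exactly when each run of σ is at least as long as the corresponding run of π. So the number of
-- σ ∈ 𝒞ₙ containing π, and with it |Av_𝒞(π)ₙ|, depends only on |π|. A decreasing π of size k lies
-- in every σ ∈ 𝒞 of size 2k, since some union of runs gives a decreasing subsequence of length k,
-- whereas the decreasing permutation of size 2k avoids every non-decreasing pattern. Finally, at
-- size |π| the class Av_𝒞(π) misses π itself, which separates patterns of different sizes.
module Submission where

open import Defs
open import Data.Empty using (⊥; ⊥-elim)
open import Data.Fin.Patterns using (0F; 1F; 2F)
open import Data.Fin as Fin using (Fin; toℕ; fromℕ<) renaming (_<_ to _<ᶠ_)
import Data.Fin.Properties as Finₚ
open import Data.List using (List; []; _∷_; _++_; length; filter; allFin; upTo; applyUpTo; cartesianProductWith)
import Data.List.Properties as Listₚ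
open import Data.List.Membership.Propositional using (_∈_)
open import Data.List.Membership.Propositional.Properties
open import Data.List.Relation.Unary.All as All using (All)
open import Data.List.Relation.Unary.AllPairs using ([]; _∷_)
open import Data.List.Relation.Unary.Any as Any using (here; there; _─_)
open import Data.List.Relation.Unary.Unique.Propositional using (Unique)
import Data.List.Relation.Unary.Unique.Propositional.Properties as Uniqueₚ
open import Data.Nat using (ℕ; zero; suc; _+_; _∸_; _≤_; _<_; z≤n; s≤s; _≤?_; _<?_)
open import Data.Nat.Properties
open import Data.Nat.Tactic.RingSolver using (solve-∀)
open import Data.Product using (Σ; ∃; _×_; _,_; proj₁; proj₂)
open import Data.Sum using (_⊎_; inj₁; inj₂; [_,_]′)
open import Data.Unit using (⊤; tt)
open import Data.Vec using (Vec; []; _∷_; lookup; tabulate)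
import Data.Vec.Properties as Vecₚ
import Data.Vec.Relation.Binary.Pointwise.Extensional as Pointwiseᵉ
open import Function.Base using (_∘_)
open import Function.Bundles using (_⇔_; mk⇔; Equivalence)
open import Relation.Binary.Definitions using (tri<; tri≈; tri>)
open import Relation.Binary.PropositionalEquality
open import Relation.Nullary using (¬_; Dec; yes; no)
open import Relation.Unary using (_≐_)
open import Relation.Nullary.Decidable using (map′; from-yes; _×-dec_; _→-dec_; ¬?)

open Equivalence using (to; from)

∈-─ : ∀ {A : Set} {x y : A} (ys : List A) (y∈ : y ∈ ys) → x ∈ ys → x ≢ y → x ∈ (ys ─ y∈)
∈-─ (_ ∷ ys) (here refl) (here refl) x≢y = ⊥-elim (x≢y refl)
∈-─ (_ ∷ ys) (here refl) (there x∈) x≢y = x∈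
∈-─ (_ ∷ ys) (there y∈) (here refl) x≢y = here refl
∈-─ (_ ∷ ys) (there y∈) (there x∈) x≢y = there (∈-─ ys y∈ x∈ x≢y)

length-≤-by-injection : ∀ {A B : Set} (R : A → B → Set) → (∀ {x x′ y} → R x y → R x′ y → x ≡ x′) →
  (xs : List A) (ys : List B) → Unique xs → (∀ {x} → x ∈ xs → ∃ λ y → y ∈ ys × R x y) →
  length xs ≤ length ys
length-≤-by-injection R inj [] ys _ _ = z≤n
length-≤-by-injection R inj (x ∷ xs) ys (x∉xs ∷ uxs) image with image (here refl)
... | y , y∈ , Rxy rewrite Listₚ.length-removeAt′ ys (Any.index y∈) =
  s≤s (length-≤-by-injection R inj xs (ys ─ y∈) uxs image′)
  where
  image′ : ∀ {x′} → x′ ∈ xs → ∃ λ y′ → y′ ∈ (ys ─ y∈) × R x′ y′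
  image′ x′∈ with image (there x′∈)
  ... | y′ , y′∈ , Rx′y′ =
    y′ , ∈-─ ys y∈ y′∈ (λ { refl → All.lookup x∉xs x′∈ (sym (inj Rx′y′ Rxy)) }) , Rx′y′

Unique-⊆⇒length-≤ : ∀ {A : Set} {xs ys : List A} → Unique xs → (∀ {x} → x ∈ xs → x ∈ ys) → length xs ≤ length ys
Unique-⊆⇒length-≤ {xs = xs} {ys} uxs ⊆ =
  length-≤-by-injection _≡_ (λ p q → trans p (sym q)) xs ys uxs (λ {x} x∈ → x , ⊆ x∈ , refl)

length-filter-+-∁ : ∀ {A : Set} {P : A → Set} (P? : ∀ x → Dec (P x)) (xs : List A) →
  length (filter P? xs) + length (filter (λ x → ¬? (P? x)) xs) ≡ length xs
length-filter-+-∁ P? [] = refl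
length-filter-+-∁ P? (x ∷ xs) with P? x
... | yes _ = cong suc (length-filter-+-∁ P? xs)
... | no _ = trans (+-suc _ _) (cong suc (length-filter-+-∁ P? xs))

allVecs : ∀ {A : Set} → List A → ∀ k → List (Vec A k)
allVecs xs zero = [] ∷ []
allVecs xs (suc k) = cartesianProductWith _∷_ xs (allVecs xs k)

allVecs-Unique : ∀ {A : Set} {xs : List A} → Unique xs → ∀ k → Unique (allVecs xs k)
allVecs-Unique uxs zero = All.[] ∷ []
allVecs-Unique uxs (suc k) = Uniqueₚ.cartesianProductWith⁺ _∷_ Vecₚ.∷-injective uxs (allVecs-Unique uxs k)

∈-allVecs : ∀ {A : Set} {xs : List A} → (∀ a → a ∈ xs) → ∀ {k} (v : Vec A k) → v ∈ allVecs xs k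
∈-allVecs complete [] = here refl
∈-allVecs complete (a ∷ v) = ∈-cartesianProductWith⁺ _∷_ (complete a) (∈-allVecs complete v)

allWords : ∀ n → List (Word n)
allWords n = allVecs (allFin n) n

enumerate : (X : Class) → (∀ {n} (w : Word n) → Dec (X w)) → ∀ n → Σ (List (Word n)) (Enumerates X n)
enumerate X X? n = filter X? (allWords n) , unique , membership
  where
  unique : Unique (filter X? (allWords n))
  unique = Uniqueₚ.filter⁺ X? (allVecs-Unique (Uniqueₚ.allFin⁺ n) n)
  membership : ∀ w → w ∈ filter X? (allWords n) ⇔ X w
  membership w = mk⇔ (λ w∈ → proj₂ (∈-filter⁻ X? {xs = allWords n} w∈)) (∈-filter⁺ X? (∈-allVecs ∈-allFin w))

_⇔-dec_ : ∀ {A B : Set} → Dec A → Dec B → Dec (A ⇔ B)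
a? ⇔-dec b? = map′ (λ (f , g) → mk⇔ f g) (λ e → to e , from e) ((a? →-dec b?) ×-dec (b? →-dec a?))

IsEmbedding : ∀ {k n} → Word k → Word n → (Fin k → Fin n) → Set
IsEmbedding p s e =
  (∀ i j → i <ᶠ j → e i <ᶠ e j) × (∀ i j → (lookup p i <ᶠ lookup p j) ⇔ (lookup s (e i) <ᶠ lookup s (e j)))

IsEmbedding? : ∀ {k n} (p : Word k) (s : Word n) e → Dec (IsEmbedding p s e)
IsEmbedding? p s e =
  Finₚ.all? (λ i → Finₚ.all? λ j → (i Finₚ.<? j) →-dec (e i Finₚ.<? e j)) ×-dec
  Finₚ.all? (λ i → Finₚ.all? λ j → (lookup p i Finₚ.<? lookup p j) ⇔-dec (lookup s (e i) Finₚ.<? lookup s (e j)))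

IsEmbedding-resp : ∀ {k n} (p : Word k) (s : Word n) {e f} → (∀ i → e i ≡ f i) → IsEmbedding p s e → IsEmbedding p s f
IsEmbedding-resp p s e≗f (mono , order) =
  (λ i j i<j → subst₂ _<ᶠ_ (e≗f i) (e≗f j) (mono i j i<j)) ,
  (λ i j → subst₂ (λ a b → (lookup p i <ᶠ lookup p j) ⇔ (lookup s a <ᶠ lookup s b)) (e≗f i) (e≗f j) (order i j))

_≼?_ : ∀ {k n} (p : Word k) (s : Word n) → Dec (p ≼ s)
_≼?_ {k} {n} p s with Any.any? (λ v → IsEmbedding? p s (lookup v)) (allVecs (allFin n) k)
... | yes found = yes (let (v , emb) = Any.satisfied found in lookup v , emb)
... | no none = no λ (e , emb) →
  none (Any.map (λ { refl → IsEmbedding-resp p s (λ i → sym (Vecₚ.lookup∘tabulate e i)) emb })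
                (∈-allVecs ∈-allFin (tabulate e)))

≼-refl : ∀ {k} {p : Word k} → p ≼ p
≼-refl = (λ i → i) , (λ _ _ i<j → i<j) , (λ _ _ → mk⇔ (λ lt → lt) (λ lt → lt))

≼-injective : ∀ {k n} {p : Word k} {s : Word n} ((e , _) : p ≼ s) → ∀ {i j} → e i ≡ e j → i ≡ j
≼-injective (e , increasing , _) {i} {j} ei≡ej with Finₚ.<-cmp i j
... | tri< i<j _ _ = ⊥-elim (<-irrefl (cong toℕ ei≡ej) (increasing i j i<j))
... | tri≈ _ i≡j _ = i≡j
... | tri> _ _ j<i = ⊥-elim (<-irrefl (cong toℕ (sym ei≡ej)) (increasing j i j<i))

IsPerm? : ∀ {n} (w : Word n) → Dec (IsPerm w)
IsPerm? w = Finₚ.all? λ i → Finₚ.all? λ j → (lookup w i Finₚ.≟ lookup w j) →-dec (i Finₚ.≟ j)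

InC? : ∀ {n} (w : Word n) → Dec (InC w)
InC? w = IsPerm? w ×-dec ¬? (p312 ≼? w) ×-dec ¬? (p123 ≼? w)

AvC? : ∀ π {n} (w : Word n) → Dec (AvC π w)
AvC? π w = InC? w ×-dec ¬? (word π ≼? w)

-- Shapes

-- A permutation of shape (m, h) and size n consists of three decreasing runs occupying the
-- positions [0, m), [m, m + h) and [m + h, n); the first run carries the middle values,
-- the second the highest values and the third the lowest values.
data Block : Set where
  mid high low : Block

block : ℕ → ℕ → ℕ → Block
block m h x with x <? m | x <? m + h
... | yes _ | _ = mid
... | no _ | yes _ = high
... | no _ | no _ = low

block≡mid⇒< : ∀ {m h x} → block m h x ≡ mid → x < m
block≡mid⇒< {m} {h} {x} eq with x <? m | x <? m + h
block≡mid⇒< eq | yes x<m | _ = x<m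
block≡mid⇒< () | no _ | yes _
block≡mid⇒< () | no _ | no _

block≡high⇒∈ : ∀ {m h x} → block m h x ≡ high → m ≤ x × x < m + h
block≡high⇒∈ {m} {h} {x} eq with x <? m | x <? m + h
block≡high⇒∈ () | yes _ | _
block≡high⇒∈ eq | no x≮m | yes x<m+h = ≮⇒≥ x≮m , x<m+h
block≡high⇒∈ () | no _ | no _

block≡low⇒≥ : ∀ {m h x} → block m h x ≡ low → m + h ≤ x
block≡low⇒≥ {m} {h} {x} eq with x <? m | x <? m + h
block≡low⇒≥ () | yes _ | _
block≡low⇒≥ () | no _ | yes _
block≡low⇒≥ eq | no _ | no x≮m+h = ≮⇒≥ x≮m+h

block≡high⇒∸<h : ∀ {m h x} → block m h x ≡ high → x ∸ m < h
block≡high⇒∸<h {m} {h} {x} eq with block≡high⇒∈ eq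
... | m≤x , x<m+h = +-cancelˡ-< m (x ∸ m) h (subst (_< m + h) (sym (m+[n∸m]≡n m≤x)) x<m+h)

<⇒block≡mid : ∀ {m h x} → x < m → block m h x ≡ mid
<⇒block≡mid {m} {h} {x} x<m with x <? m | x <? m + h
... | yes _ | _ = refl
... | no x≮m | _ = ⊥-elim (x≮m x<m)

∈⇒block≡high : ∀ {m h x} → m ≤ x → x < m + h → block m h x ≡ high
∈⇒block≡high {m} {h} {x} m≤x x<m+h with x <? m | x <? m + h
... | yes x<m | _ = ⊥-elim (≤⇒≯ m≤x x<m)
... | no _ | yes _ = refl
... | no _ | no x≮m+h = ⊥-elim (x≮m+h x<m+h)

≥⇒block≡low : ∀ {m h x} → m + h ≤ x → block m h x ≡ low
≥⇒block≡low {m} {h} {x} m+h≤x with x <? m | x <? m + h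
... | yes x<m | _ = ⊥-elim (≤⇒≯ (≤-trans (m≤m+n m h) m+h≤x) x<m)
... | no _ | yes x<m+h = ⊥-elim (≤⇒≯ m+h≤x x<m+h)
... | no _ | no _ = refl

-- BelowIn B C x y: in a shaped permutation, the entry at position x (in run B) lies below the one at y (in run C).
BelowIn : Block → Block → ℕ → ℕ → Set
BelowIn mid mid x y = y < x
BelowIn mid high _ _ = ⊤
BelowIn mid low _ _ = ⊥
BelowIn high mid _ _ = ⊥
BelowIn high high x y = y < x
BelowIn high low _ _ = ⊥
BelowIn low mid _ _ = ⊤
BelowIn low high _ _ = ⊤
BelowIn low low x y = y < x

Below : ℕ → ℕ → ℕ → ℕ → Set
Below m h x y = BelowIn (block m h x) (block m h y) x y

record HasShape {n} (m h : ℕ) (w : Word n) : Set where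
  constructor mkShape
  field below⇒< : ∀ i j → Below m h (toℕ i) (toℕ j) → lookup w i <ᶠ lookup w j
open HasShape public

BelowIn-connex : ∀ B C {x y} → x ≢ y → BelowIn B C x y ⊎ BelowIn C B y x
BelowIn-connex mid high _ = inj₁ tt
BelowIn-connex high mid _ = inj₂ tt
BelowIn-connex low mid _ = inj₁ tt
BelowIn-connex mid low _ = inj₂ tt
BelowIn-connex low high _ = inj₁ tt
BelowIn-connex high low _ = inj₂ tt
BelowIn-connex mid mid x≢y = >-or-< x≢y
  where
  >-or-< : ∀ {x y} → x ≢ y → y < x ⊎ x < y
  >-or-< {x} {y} x≢y with <-cmp x y
  ... | tri< x<y _ _ = inj₂ x<y
  ... | tri≈ _ x≡y _ = ⊥-elim (x≢y x≡y)
  ... | tri> _ _ y<x = inj₁ y<x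
BelowIn-connex high high x≢y = BelowIn-connex mid mid x≢y
BelowIn-connex low low x≢y = BelowIn-connex mid mid x≢y

Below-connex : ∀ m h {x y} → x ≢ y → Below m h x y ⊎ Below m h y x
Below-connex m h {x} {y} = BelowIn-connex (block m h x) (block m h y)

Below-ascent : ∀ m h {x y} → x < y → Below m h x y → block m h x ≡ mid × block m h y ≡ high
Below-ascent m h {x} {y} x<y below with block m h x in bx | block m h y in by
... | mid | mid = ⊥-elim (<-asym x<y below)
... | mid | high = refl , refl
... | high | high = ⊥-elim (<-asym x<y below)
... | low | low = ⊥-elim (<-asym x<y below)
... | low | mid = ⊥-elim (≤⇒≯ (≤-trans (m≤m+n m h) (block≡low⇒≥ bx)) (<-trans x<y (block≡mid⇒< by)))
... | low | high = ⊥-elim (≤⇒≯ (block≡low⇒≥ bx) (<-trans x<y (proj₂ (block≡high⇒∈ by))))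

HasShape⇒<⇔Below : ∀ {n m h} {w : Word n} → HasShape m h w →
  ∀ i j → (lookup w i <ᶠ lookup w j) ⇔ Below m h (toℕ i) (toℕ j)
HasShape⇒<⇔Below {m = m} {h} {w} shaped i j = mk⇔ <⇒Below (below⇒< shaped i j)
  where
  <⇒Below : lookup w i <ᶠ lookup w j → Below m h (toℕ i) (toℕ j)
  <⇒Below w<w with Below-connex m h (λ eq → <-irrefl (cong (toℕ ∘ lookup w) (Finₚ.toℕ-injective eq)) w<w)
  ... | inj₁ below = below
  ... | inj₂ above = ⊥-elim (<-asym w<w (below⇒< shaped j i above))

HasShape⇒IsPerm : ∀ {n m h} {w : Word n} → HasShape m h w → IsPerm w
HasShape⇒IsPerm {m = m} {h} shaped i j wi≡wj with i Finₚ.≟ j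
... | yes i≡j = i≡j
... | no i≢j with Below-connex m h (i≢j ∘ Finₚ.toℕ-injective)
...   | inj₁ below = ⊥-elim (<-irrefl (cong toℕ wi≡wj) (below⇒< shaped i j below))
...   | inj₂ above = ⊥-elim (<-irrefl (cong toℕ (sym wi≡wj)) (below⇒< shaped j i above))

shapeValueIn : ℕ → ℕ → ℕ → ℕ → Block → ℕ
shapeValueIn n m h x mid = n ∸ h ∸ suc x
shapeValueIn n m h x high = n ∸ suc (x ∸ m)
shapeValueIn n m h x low = n ∸ suc x

shapeValue : ℕ → ℕ → ℕ → ℕ → ℕ
shapeValue n m h x = shapeValueIn n m h x (block m h x)

shapeValue<n : ∀ {n m h x} → x < n → shapeValue n m h x < n
shapeValue<n {suc n} {m} {h} {x} _ with block m h x
... | mid = s≤s (≤-trans (∸-monoˡ-≤ (suc x) (m∸n≤m (suc n) h)) (m∸n≤m n x))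
... | high = s≤s (m∸n≤m n (x ∸ m))
... | low = s≤s (m∸n≤m n x)

shapeValue-mono : ∀ {n m h x y} → m + h ≤ n → x < n → Below m h x y → shapeValue n m h x < shapeValue n m h y
shapeValue-mono {n} {m} {h} {x} {y} m+h≤n x<n below with block m h x in bx | block m h y in by
... | mid | mid = ∸-monoʳ-< (s≤s below) (≤-trans (block≡mid⇒< bx) (m+n≤o⇒m≤o∸n m m+h≤n))
... | high | high = ∸-monoʳ-< (s≤s (∸-monoˡ-< below (proj₁ (block≡high⇒∈ by))))
                              (≤-trans (block≡high⇒∸<h bx) (m+n≤o⇒n≤o m m+h≤n))
... | low | low = ∸-monoʳ-< (s≤s below) x<n
... | mid | high = <-≤-trans (∸-monoʳ-< {o = 0} (s≤s z≤n) (≤-trans (block≡mid⇒< bx) (m+n≤o⇒m≤o∸n m m+h≤n)))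
                              (∸-monoʳ-≤ n (block≡high⇒∸<h by))
... | low | mid = subst (n ∸ suc x <_) (sym (∸-+-assoc n h (suc y)))
                    (∸-monoʳ-< (s≤s (≤-trans (+-monoʳ-≤ h (block≡mid⇒< by))
                                             (≤-trans (≤-reflexive (+-comm h m)) (block≡low⇒≥ bx)))) x<n)
... | low | high = ∸-monoʳ-< (s≤s (<-≤-trans (block≡high⇒∸<h by) (≤-trans (m≤n+m h m) (block≡low⇒≥ bx)))) x<n

shapeValue-injective : ∀ {n m h x y} → m + h ≤ n → x < n → y < n → shapeValue n m h x ≡ shapeValue n m h y → x ≡ y
shapeValue-injective {m = m} {h} {x} {y} m+h≤n x<n y<n eq with x ≟ y
... | yes x≡y = x≡y
... | no x≢y with Below-connex m h x≢y
...   | inj₁ below = ⊥-elim (<-irrefl eq (shapeValue-mono m+h≤n x<n below))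
...   | inj₂ above = ⊥-elim (<-irrefl (sym eq) (shapeValue-mono m+h≤n y<n above))

shapePerm : ∀ n m h → Word n
shapePerm n m h = tabulate λ i → fromℕ< (shapeValue<n {n} {m} {h} (Finₚ.toℕ<n i))

toℕ-lookup-shapePerm : ∀ n m h (i : Fin n) → toℕ (lookup (shapePerm n m h) i) ≡ shapeValue n m h (toℕ i)
toℕ-lookup-shapePerm n m h i = trans (cong toℕ (Vecₚ.lookup∘tabulate _ i)) (Finₚ.toℕ-fromℕ< _)

shapePerm-HasShape : ∀ {n m h} → m + h ≤ n → HasShape m h (shapePerm n m h)
shapePerm-HasShape {n} {m} {h} m+h≤n = mkShape λ i j below →
  subst₂ _<_ (sym (toℕ-lookup-shapePerm n m h i)) (sym (toℕ-lookup-shapePerm n m h j))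
    (shapeValue-mono m+h≤n (Finₚ.toℕ<n i) below)

toℕ-lookup-shapePerm-fromℕ< : ∀ {n} m h {x} (x<n : x < n) → toℕ (lookup (shapePerm n m h) (fromℕ< x<n)) ≡ shapeValue n m h x
toℕ-lookup-shapePerm-fromℕ< {n} m h x<n = trans (toℕ-lookup-shapePerm n m h _) (cong (shapeValue n m h) (Finₚ.toℕ-fromℕ< x<n))

shapeValue-0 : ∀ n {m} h → 0 < m → shapeValue n m h 0 ≡ n ∸ (h + 1)
shapeValue-0 n {m} h 0<m = trans (cong (shapeValueIn n m h 0) (<⇒block≡mid 0<m)) (∸-+-assoc n h 1)

shapeValue-m : ∀ n m {h} → 0 < h → shapeValue n m h m ≡ n ∸ 1
shapeValue-m n m {h} 0<h = trans (cong (shapeValueIn n m h m) (∈⇒block≡high ≤-refl (m<m+n m 0<h)))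
                                 (cong (λ d → n ∸ suc d) (n∸n≡0 m))

-- Two non-degenerate shapes give different permutations: the entry at position 0 is
-- n ∸ (h + 1), and the largest entry sits at position m.
shapePerm-injective : ∀ {n m₁ h₁ m₂ h₂} → m₁ + h₁ ≤ n → m₂ + h₂ ≤ n → 0 < m₁ → 0 < h₁ → 0 < m₂ → 0 < h₂ →
  shapePerm n m₁ h₁ ≡ shapePerm n m₂ h₂ → m₁ ≡ m₂ × h₁ ≡ h₂
shapePerm-injective {n} {m₁} {h₁} {m₂} {h₂} fits₁ fits₂ 0<m₁ 0<h₁ 0<m₂ 0<h₂ eq = m₁≡m₂ , h₁≡h₂
  where
  sameValue : ∀ {x} → x < n → shapeValue n m₁ h₁ x ≡ shapeValue n m₂ h₂ x
  sameValue x<n = begin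
    shapeValue n m₁ h₁ _                           ≡⟨ toℕ-lookup-shapePerm-fromℕ< m₁ h₁ x<n ⟨
    toℕ (lookup (shapePerm n m₁ h₁) (fromℕ< x<n)) ≡⟨ cong (λ w → toℕ (lookup w (fromℕ< x<n))) eq ⟩
    toℕ (lookup (shapePerm n m₂ h₂) (fromℕ< x<n)) ≡⟨ toℕ-lookup-shapePerm-fromℕ< m₂ h₂ x<n ⟩
    shapeValue n m₂ h₂ _                           ∎
    where open ≡-Reasoning
  h+1≤n : ∀ {m h} → 0 < m → m + h ≤ n → h + 1 ≤ n
  h+1≤n {m} {h} 0<m fits = ≤-trans (+-monoʳ-≤ h 0<m) (≤-trans (≤-reflexive (+-comm h m)) fits)
  m<n : ∀ {m h} → 0 < h → m + h ≤ n → m < n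
  m<n {m} 0<h fits = <-≤-trans (m<m+n m 0<h) fits
  h₁≡h₂ : h₁ ≡ h₂
  h₁≡h₂ = +-cancelʳ-≡ 1 h₁ h₂ (∸-cancelˡ-≡ (h+1≤n 0<m₁ fits₁) (h+1≤n 0<m₂ fits₂)
    (trans (sym (shapeValue-0 n h₁ 0<m₁))
      (trans (sameValue (<-≤-trans 0<m₁ (m+n≤o⇒m≤o m₁ fits₁))) (shapeValue-0 n h₂ 0<m₂))))
  m₁≡m₂ : m₁ ≡ m₂
  m₁≡m₂ = shapeValue-injective {m = m₂} {h₂} fits₂ (m<n 0<h₁ fits₁) (m<n 0<h₂ fits₂)
    (trans (sym (sameValue (m<n 0<h₁ fits₁))) (trans (shapeValue-m n m₁ 0<h₁) (sym (shapeValue-m n m₂ 0<h₂))))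

-- A permutation is determined by its order pattern, hence by its shape

rank : ∀ {n} → Word n → Fin n → ℕ
rank {n} w i = length (filter (λ j → lookup w j Finₚ.<? lookup w i) (allFin n))

-- The entries below w i inject into [0, w i) and the others into [w i, n); both bounds are tight.
IsPerm⇒toℕ≡rank : ∀ {n} (w : Word n) → IsPerm w → ∀ i → toℕ (lookup w i) ≡ rank w i
IsPerm⇒toℕ≡rank {n} w perm i = ≤-antisym (≮⇒≥ v≮#below) #below≤v
  where
  v : ℕ
  v = toℕ (lookup w i)
  below? : ∀ j → Dec (lookup w j <ᶠ lookup w i)
  below? j = lookup w j Finₚ.<? lookup w i
  below above : List (Fin n)
  below = filter below? (allFin n)
  above = filter (λ j → ¬? (below? j)) (allFin n)
  HasValue : Fin n → ℕ → Set
  HasValue j x = toℕ (lookup w j) ≡ x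
  HasValue-injective : ∀ {j j′ x} → HasValue j x → HasValue j′ x → j ≡ j′
  HasValue-injective p q = perm _ _ (Finₚ.toℕ-injective (trans p (sym q)))
  #below≤v : length below ≤ v
  #below≤v = subst (length below ≤_) (Listₚ.length-upTo v)
    (length-≤-by-injection HasValue HasValue-injective below (upTo v) (Uniqueₚ.filter⁺ below? (Uniqueₚ.allFin⁺ n))
      λ j∈ → _ , ∈-upTo⁺ (proj₂ (∈-filter⁻ below? {xs = allFin n} j∈)) , refl)
  #above≤n∸v : length above ≤ n ∸ v
  #above≤n∸v = subst (length above ≤_) (Listₚ.length-applyUpTo (v +_) (n ∸ v))
    (length-≤-by-injection HasValue HasValue-injective above (applyUpTo (v +_) (n ∸ v))
      (Uniqueₚ.filter⁺ (λ j → ¬? (below? j)) (Uniqueₚ.allFin⁺ n))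
      λ {j} j∈ → let v≤wj = ≮⇒≥ (proj₂ (∈-filter⁻ (λ j → ¬? (below? j)) {xs = allFin n} j∈)) in
        v + (toℕ (lookup w j) ∸ v) , ∈-applyUpTo⁺ (v +_) (∸-monoˡ-< (Finₚ.toℕ<n (lookup w j)) v≤wj) ,
        sym (m+[n∸m]≡n v≤wj))
  v≮#below : ¬ (length below < v)
  v≮#below #below<v = <-irrefl (trans (length-filter-+-∁ below? (allFin n)) (Listₚ.length-tabulate (λ j → j)))
    (<-≤-trans (+-mono-<-≤ #below<v #above≤n∸v) (≤-reflexive (m+[n∸m]≡n (<⇒≤ (Finₚ.toℕ<n (lookup w i))))))

IsPerm-≡-byOrder : ∀ {n} (w w′ : Word n) → IsPerm w → IsPerm w′ →
  (∀ i j → (lookup w i <ᶠ lookup w j) ⇔ (lookup w′ i <ᶠ lookup w′ j)) → w ≡ w′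
IsPerm-≡-byOrder {n} w w′ perm perm′ sameOrder = Pointwiseᵉ.Pointwise-≡⇒≡ (Pointwiseᵉ.ext λ i →
  Finₚ.toℕ-injective (begin
    toℕ (lookup w i)   ≡⟨ IsPerm⇒toℕ≡rank w perm i ⟩
    rank w i           ≡⟨ cong length (Listₚ.filter-≐ _ _ sameBelow (allFin n)) ⟩
    rank w′ i          ≡⟨ IsPerm⇒toℕ≡rank w′ perm′ i ⟨
    toℕ (lookup w′ i)  ∎))
  where
  open ≡-Reasoning
  sameBelow : ∀ {i} → (λ j → lookup w j <ᶠ lookup w i) ≐ (λ j → lookup w′ j <ᶠ lookup w′ i)
  sameBelow {i} = (λ {j} → to (sameOrder j i)) , (λ {j} → from (sameOrder j i))

HasShape-unique : ∀ {n m h} {w w′ : Word n} → HasShape m h w → HasShape m h w′ → w ≡ w′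
HasShape-unique {w = w} {w′} shaped shaped′ =
  IsPerm-≡-byOrder w w′ (HasShape⇒IsPerm shaped) (HasShape⇒IsPerm shaped′) λ i j →
    mk⇔ (from (HasShape⇒<⇔Below shaped′ i j) ∘ to (HasShape⇒<⇔Below shaped i j))
        (from (HasShape⇒<⇔Below shaped i j) ∘ to (HasShape⇒<⇔Below shaped′ i j))

triple : ∀ {n} → Fin n → Fin n → Fin n → Fin 3 → Fin n
triple a b c 0F = a
triple a b c 1F = b
triple a b c 2F = c

triple-increasing : ∀ {n} {a b c : Fin n} → a <ᶠ b → b <ᶠ c → ∀ i j → i <ᶠ j → triple a b c i <ᶠ triple a b c j
triple-increasing a<b b<c 0F 1F _ = a<b
triple-increasing a<b b<c 0F 2F _ = <-trans a<b b<c
triple-increasing a<b b<c 1F 2F _ = b<c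
triple-increasing a<b b<c 1F 1F (s≤s ())
triple-increasing a<b b<c 2F 1F (s≤s ())
triple-increasing a<b b<c 2F 2F (s≤s (s≤s ()))

<-preserved⇒reflected : ∀ {k n} {p : Word k} (s : Word n) (e : Fin k → Fin n) → IsPerm p →
  (∀ i j → lookup p i <ᶠ lookup p j → lookup s (e i) <ᶠ lookup s (e j)) →
  ∀ i j → (lookup p i <ᶠ lookup p j) ⇔ (lookup s (e i) <ᶠ lookup s (e j))
<-preserved⇒reflected {p = p} s e perm preserved i j = mk⇔ (preserved i j) reflected
  where
  reflected : lookup s (e i) <ᶠ lookup s (e j) → lookup p i <ᶠ lookup p j
  reflected s<s with Finₚ.<-cmp (lookup p i) (lookup p j)
  ... | tri< p<p _ _ = p<p
  ... | tri≈ _ p≡p _ rewrite perm i j p≡p = ⊥-elim (<-irrefl refl s<s)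
  ... | tri> _ _ p>p = ⊥-elim (<-asym s<s (preserved j i p>p))

contains123 : ∀ {n} (σ : Word n) {a b c} → a <ᶠ b → b <ᶠ c →
  lookup σ a <ᶠ lookup σ b → lookup σ b <ᶠ lookup σ c → p123 ≼ σ
contains123 σ {a} {b} {c} a<b b<c σa<σb σb<σc =
  triple a b c , triple-increasing a<b b<c , <-preserved⇒reflected {p = p123} σ (triple a b c) (from-yes (IsPerm? p123)) preserved
  where
  preserved : ∀ i j → lookup p123 i <ᶠ lookup p123 j → lookup σ (triple a b c i) <ᶠ lookup σ (triple a b c j)
  preserved 0F 1F _ = σa<σb
  preserved 0F 2F _ = <-trans σa<σb σb<σc
  preserved 1F 2F _ = σb<σc
  preserved 1F 1F (s≤s ())
  preserved 2F 1F (s≤s ())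
  preserved 2F 2F (s≤s (s≤s ()))

contains312 : ∀ {n} (σ : Word n) {a b c} → a <ᶠ b → b <ᶠ c →
  lookup σ b <ᶠ lookup σ c → lookup σ c <ᶠ lookup σ a → p312 ≼ σ
contains312 σ {a} {b} {c} a<b b<c σb<σc σc<σa =
  triple a b c , triple-increasing a<b b<c , <-preserved⇒reflected {p = p312} σ (triple a b c) (from-yes (IsPerm? p312)) preserved
  where
  preserved : ∀ i j → lookup p312 i <ᶠ lookup p312 j → lookup σ (triple a b c i) <ᶠ lookup σ (triple a b c j)
  preserved 1F 0F _ = <-trans σb<σc σc<σa
  preserved 1F 2F _ = σb<σc
  preserved 2F 0F _ = σc<σa
  preserved 0F 0F (s≤s (s≤s ()))
  preserved 0F 1F ()
  preserved 0F 2F (s≤s ())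
  preserved 1F 1F ()
  preserved 2F 1F ()
  preserved 2F 2F (s≤s ())

HasShape-ascent : ∀ {n m h} {w : Word n} → HasShape m h w → ∀ {i j} → i <ᶠ j → lookup w i <ᶠ lookup w j →
  block m h (toℕ i) ≡ mid × block m h (toℕ j) ≡ high
HasShape-ascent {m = m} {h} shaped {i} {j} i<j wi<wj = Below-ascent m h i<j (to (HasShape⇒<⇔Below shaped i j) wi<wj)

HasShape⇒avoids123 : ∀ {n m h} {w : Word n} → HasShape m h w → ¬ (p123 ≼ w)
HasShape⇒avoids123 shaped (e , increasing , sameOrder)
  with HasShape-ascent shaped (increasing 0F 1F (s≤s z≤n)) (to (sameOrder 0F 1F) (s≤s z≤n))
     | HasShape-ascent shaped (increasing 1F 2F (s≤s (s≤s z≤n))) (to (sameOrder 1F 2F) (s≤s (s≤s z≤n)))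
... | _ , e₁-high | e₁-mid , _ with trans (sym e₁-high) e₁-mid
... | ()

-- The 1 and 2 of a 312 form an ascent, so they lie in the first and second run, and the 3 lies
-- before them, in the first run; but no entry of the second run is below one of the first.
HasShape⇒avoids312 : ∀ {n m h} {w : Word n} → HasShape m h w → ¬ (p312 ≼ w)
HasShape⇒avoids312 {m = m} {h} shaped (e , increasing , sameOrder)
  with HasShape-ascent shaped (increasing 1F 2F (s≤s (s≤s z≤n))) (to (sameOrder 1F 2F) (s≤s z≤n))
... | e₁-mid , e₂-high =
  subst₂ (λ B C → BelowIn B C (toℕ (e 2F)) (toℕ (e 0F))) e₂-high e₀-mid
    (to (HasShape⇒<⇔Below shaped (e 2F) (e 0F)) (to (sameOrder 2F 0F) (s≤s (s≤s z≤n))))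
  where
  e₀-mid : block m h (toℕ (e 0F)) ≡ mid
  e₀-mid = <⇒block≡mid (<-trans (increasing 0F 1F (s≤s z≤n)) (block≡mid⇒< e₁-mid))

HasShape⇒InC : ∀ {n m h} {w : Word n} → HasShape m h w → InC w
HasShape⇒InC shaped = HasShape⇒IsPerm shaped , HasShape⇒avoids312 shaped , HasShape⇒avoids123 shaped

-- Every permutation in Av(312, 123) has a shape

-- Outside [0, k) the junk value 0.
at : ∀ {k n} → (Fin k → Fin n) → ℕ → ℕ
at {k} f x with x <? k
... | yes x<k = toℕ (f (fromℕ< x<k))
... | no _ = 0

at-toℕ : ∀ {k n} (f : Fin k → Fin n) i → at f (toℕ i) ≡ toℕ (f i)
at-toℕ {k} f i with toℕ i <? k
... | yes i<k = cong (toℕ ∘ f) (Finₚ.fromℕ<-toℕ i i<k)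
... | no i≮k = ⊥-elim (i≮k (Finₚ.toℕ<n i))

at-fromℕ< : ∀ {k n} (f : Fin k → Fin n) {x} (x<k : x < k) → at f x ≡ toℕ (f (fromℕ< x<k))
at-fromℕ< f x<k = trans (cong (at f) (sym (Finₚ.toℕ-fromℕ< x<k))) (at-toℕ f (fromℕ< x<k))

fromℕ<-mono : ∀ {n x y} (x<n : x < n) (y<n : y < n) → x < y → fromℕ< x<n <ᶠ fromℕ< y<n
fromℕ<-mono x<n y<n = subst₂ _<_ (sym (Finₚ.toℕ-fromℕ< x<n)) (sym (Finₚ.toℕ-fromℕ< y<n))

least? : ∀ {P : ℕ → Set} → (∀ x → Dec (P x)) → ∀ n →
  (∀ {x} → x < n → ¬ P x) ⊎ (∃ λ x → x < n × P x × (∀ {y} → y < x → ¬ P y))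
least? P? zero = inj₁ λ ()
least? P? (suc n) with least? P? n
... | inj₂ (x , x<n , Px , minimal) = inj₂ (x , m<n⇒m<1+n x<n , Px , minimal)
... | inj₁ none with P? n
...   | yes Pn = inj₂ (n , ≤-refl , Pn , none)
...   | no ¬Pn = inj₁ λ x<1+n → [ none , (λ { refl → ¬Pn }) ]′ (m<1+n⇒m<n∨m≡n x<1+n)

module Structure {n} {σ : Word n} (inC : InC σ) where

  entry : ℕ → ℕ
  entry = at (lookup σ)

  entry-injective : ∀ {x y} → x < n → y < n → entry x ≡ entry y → x ≡ y
  entry-injective {x} {y} x<n y<n eq = begin
    x                     ≡⟨ Finₚ.toℕ-fromℕ< x<n ⟨
    toℕ (fromℕ< x<n)      ≡⟨ cong toℕ (proj₁ inC _ _ (Finₚ.toℕ-injective (begin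
      toℕ (lookup σ (fromℕ< x<n)) ≡⟨ at-fromℕ< (lookup σ) x<n ⟨
      entry x                   ≡⟨ eq ⟩
      entry y                   ≡⟨ at-fromℕ< (lookup σ) y<n ⟩
      toℕ (lookup σ (fromℕ< y<n)) ∎))) ⟩
    toℕ (fromℕ< y<n)      ≡⟨ Finₚ.toℕ-fromℕ< y<n ⟩
    y                     ∎
    where open ≡-Reasoning

  entry-connex : ∀ {x y} → x < n → y < n → x ≢ y → entry x < entry y ⊎ entry y < entry x
  entry-connex {x} {y} x<n y<n x≢y with <-cmp (entry x) (entry y)
  ... | tri< lt _ _ = inj₁ lt
  ... | tri≈ _ eq _ = ⊥-elim (x≢y (entry-injective x<n y<n eq))
  ... | tri> _ _ gt = inj₂ gt

  no123 : ∀ {a b c} → a < b → b < c → c < n → entry a < entry b → entry b < entry c → ⊥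
  no123 {a} {b} {c} a<b b<c c<n σa<σb σb<σc = proj₂ (proj₂ inC)
    (contains123 σ (fromℕ<-mono a<n b<n a<b) (fromℕ<-mono b<n c<n b<c)
      (subst₂ _<_ (at-fromℕ< (lookup σ) a<n) (at-fromℕ< (lookup σ) b<n) σa<σb)
      (subst₂ _<_ (at-fromℕ< (lookup σ) b<n) (at-fromℕ< (lookup σ) c<n) σb<σc))
    where
    b<n : b < n
    b<n = <-trans b<c c<n
    a<n : a < n
    a<n = <-trans a<b b<n

  no312 : ∀ {a b c} → a < b → b < c → c < n → entry b < entry c → entry c < entry a → ⊥
  no312 {a} {b} {c} a<b b<c c<n σb<σc σc<σa = proj₁ (proj₂ inC)
    (contains312 σ (fromℕ<-mono a<n b<n a<b) (fromℕ<-mono b<n c<n b<c)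
      (subst₂ _<_ (at-fromℕ< (lookup σ) b<n) (at-fromℕ< (lookup σ) c<n) σb<σc)
      (subst₂ _<_ (at-fromℕ< (lookup σ) c<n) (at-fromℕ< (lookup σ) a<n) σc<σa))
    where
    b<n : b < n
    b<n = <-trans b<c c<n
    a<n : a < n
    a<n = <-trans a<b b<n

  v : ℕ
  v = entry 0

  below-v : ∀ {x} → 0 < x → x < n → ¬ (v < entry x) → entry x < v
  below-v 0<x x<n v≮σx = ≤∧≢⇒< (≮⇒≥ v≮σx) λ eq → <-irrefl (sym (entry-injective x<n (<-trans 0<x x<n) eq)) 0<x

  above-v : ∀ {x} → 0 < x → x < n → ¬ (entry x < v) → v < entry x
  above-v 0<x x<n σx≮v = ≤∧≢⇒< (≮⇒≥ σx≮v) λ eq → <-irrefl (sym (entry-injective x<n (<-trans 0<x x<n) (sym eq))) 0<x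

  -- Position 0 would complete a 312 resp. a 123.
  descent-below-v : ∀ {x y} → y < x → x < n → entry x < v → entry x < entry y
  descent-below-v {y = zero} _ _ σx<v = σx<v
  descent-below-v {x} {suc y} y<x x<n σx<v with entry-connex x<n (<-trans y<x x<n) (λ eq → <-irrefl (sym eq) y<x)
  ... | inj₁ σx<σy = σx<σy
  ... | inj₂ σy<σx = ⊥-elim (no312 (s≤s z≤n) y<x x<n σy<σx σx<v)

  descent-above-v : ∀ {x y} → 0 < y → y < x → x < n → v < entry y → entry x < entry y
  descent-above-v 0<y y<x x<n v<σy with entry-connex x<n (<-trans y<x x<n) (λ eq → <-irrefl (sym eq) y<x)
  ... | inj₁ σx<σy = σx<σy
  ... | inj₂ σy<σx = ⊥-elim (no123 0<y y<x x<n v<σy σy<σx)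

  record Profile (m q : ℕ) : Set where
    field
      0<m : 0 < m
      m≤q : m ≤ q
      q≤n : q ≤ n
      first : ∀ {x} → 0 < x → x < m → entry x < v
      second : ∀ {x} → m ≤ x → x < q → v < entry x
      third : ∀ {x} → q ≤ x → x < n → entry x < v

  Profile⇒HasShape : ∀ {m q} → Profile m q → HasShape m (q ∸ m) σ
  Profile⇒HasShape {m} {q} profile = mkShape λ i j below →
    subst₂ _<_ (at-toℕ (lookup σ) i) (at-toℕ (lookup σ) j) (ordered (Finₚ.toℕ<n i) below)
    where
    open Profile profile
    h : ℕ
    h = q ∸ m
    m+h≡q : m + h ≡ q
    m+h≡q = m+[n∸m]≡n m≤q
    ordered : ∀ {x y} → x < n → Below m h x y → entry x < entry y
    ordered {x} {y} x<n below with block m h x in bx | block m h y in by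
    ... | mid | mid = descent-below-v below x<n (first (<-≤-trans (s≤s z≤n) below) (block≡mid⇒< bx))
    ... | low | mid = descent-below-v (<-≤-trans (block≡mid⇒< by) (≤-trans m≤q q≤x)) x<n (third q≤x x<n)
      where
      q≤x : q ≤ x
      q≤x = subst (_≤ x) m+h≡q (block≡low⇒≥ bx)
    ... | low | low = descent-below-v below x<n (third (subst (_≤ x) m+h≡q (block≡low⇒≥ bx)) x<n)
    ... | high | high = descent-above-v (<-≤-trans 0<m m≤y) below x<n (second m≤y (subst (y <_) m+h≡q y<m+h))
      where
      m≤y : m ≤ y
      m≤y = proj₁ (block≡high⇒∈ by)
      y<m+h : y < m + h
      y<m+h = proj₂ (block≡high⇒∈ by)
    ... | mid | high = ≤-<-trans (σx≤v x (block≡mid⇒< bx)) v<σy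
      where
      v<σy : v < entry y
      v<σy = second (proj₁ (block≡high⇒∈ by)) (subst (y <_) m+h≡q (proj₂ (block≡high⇒∈ by)))
      σx≤v : ∀ x → x < m → entry x ≤ v
      σx≤v zero _ = ≤-refl
      σx≤v (suc x) x<m = <⇒≤ (first (s≤s z≤n) x<m)
    ... | low | high = <-trans (third (subst (_≤ x) m+h≡q (block≡low⇒≥ bx)) x<n)
                               (second (proj₁ (block≡high⇒∈ by)) (subst (y <_) m+h≡q (proj₂ (block≡high⇒∈ by))))

  v<entry⇒0< : ∀ {x} → v < entry x → 0 < x
  v<entry⇒0< {zero} v<v = ⊥-elim (<-irrefl refl v<v)
  v<entry⇒0< {suc _} _ = s≤s z≤n

  profile : 0 < n → Σ ℕ λ m → Σ ℕ λ q → Profile m q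
  profile 0<n with least? (λ x → v <? entry x) n
  ... | inj₁ noneAbove = n , n , record
    { 0<m = 0<n ; m≤q = ≤-refl ; q≤n = ≤-refl
    ; first = λ 0<x x<n → below-v 0<x x<n (noneAbove x<n)
    ; second = λ n≤x x<n → ⊥-elim (≤⇒≯ n≤x x<n)
    ; third = λ n≤x x<n → ⊥-elim (≤⇒≯ n≤x x<n) }
  ... | inj₂ (m , m<n , v<σm , noneAboveBefore-m) with least? (λ x → (m ≤? x) ×-dec (entry x <? v)) n
  ...   | inj₁ noneBelowAfter-m = m , n , record
    { 0<m = 0<m ; m≤q = <⇒≤ m<n ; q≤n = ≤-refl
    ; first = λ 0<x x<m → below-v 0<x (<-trans x<m m<n) (noneAboveBefore-m x<m)
    ; second = λ m≤x x<n → above-v (<-≤-trans 0<m m≤x) x<n λ σx<v → noneBelowAfter-m x<n (m≤x , σx<v)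
    ; third = λ n≤x x<n → ⊥-elim (≤⇒≯ n≤x x<n) }
    where
    0<m : 0 < m
    0<m = v<entry⇒0< v<σm
  ...   | inj₂ (q , q<n , (m≤q , σq<v) , noneBelowBefore-q) = m , q , record
    { 0<m = 0<m ; m≤q = m≤q ; q≤n = <⇒≤ q<n
    ; first = λ 0<x x<m → below-v 0<x (<-trans x<m m<n) (noneAboveBefore-m x<m)
    ; second = λ m≤x x<q → above-v (<-≤-trans 0<m m≤x) (<-trans x<q q<n) λ σx<v → noneBelowBefore-q x<q (m≤x , σx<v)
    ; third = third }
    where
    0<m : 0 < m
    0<m = v<entry⇒0< v<σm
    m<q : m < q
    m<q = ≤∧≢⇒< m≤q λ { refl → <-asym v<σm σq<v }
    -- An entry above v after q would complete a 123 with 0 and m, or a 312 with m and q.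
    third : ∀ {x} → q ≤ x → x < n → entry x < v
    third {x} q≤x x<n with m≤n⇒m<n∨m≡n q≤x
    ... | inj₂ refl = σq<v
    ... | inj₁ q<x = below-v (<-≤-trans 0<m (≤-trans m≤q q≤x)) x<n notAbove
      where
      notAbove : ¬ (v < entry x)
      notAbove v<σx with entry-connex m<n x<n (λ eq → <-irrefl eq (<-trans m<q q<x))
      ... | inj₁ σm<σx = no123 0<m (<-trans m<q q<x) x<n v<σm σm<σx
      ... | inj₂ σx<σm = no312 m<q q<x x<n (<-trans σq<v v<σx) σx<σm

InC⇒HasShape : ∀ {n} {σ : Word n} → InC σ → Σ ℕ λ m → Σ ℕ λ h → m + h ≤ n × HasShape m h σ
InC⇒HasShape {zero} _ = 0 , 0 , z≤n , mkShape λ ()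
InC⇒HasShape {suc n} inC with Structure.profile inC (s≤s z≤n)
... | m , q , profile =
  m , q ∸ m , subst (_≤ suc n) (sym (m+[n∸m]≡n m≤q)) q≤n , Structure.Profile⇒HasShape inC profile
  where open Structure.Profile profile

-- Containment between shaped permutations

-- Each run of the smaller shape is sent to the beginning of the corresponding run of the larger one.
module Stretch {k n m′ h′ m h : ℕ} (m+h≤n : m + h ≤ n) (m′≤m : m′ ≤ m) (h′≤h : h′ ≤ h)
               (l′≤l : k ∸ (m′ + h′) ≤ n ∸ (m + h)) where

  stretchIn : Block → ℕ → ℕ
  stretchIn mid x = x
  stretchIn high x = m + (x ∸ m′)
  stretchIn low x = m + h + (x ∸ (m′ + h′))

  stretch : ℕ → ℕ
  stretch x = stretchIn (block m′ h′ x) x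

  stretch<n : ∀ {x} → x < k → stretch x < n
  stretch<n {x} x<k with block m′ h′ x in bx
  ... | mid = <-≤-trans (block≡mid⇒< bx) (≤-trans m′≤m (m+n≤o⇒m≤o m m+h≤n))
  ... | high = <-≤-trans (+-monoʳ-< m (<-≤-trans (block≡high⇒∸<h bx) h′≤h)) m+h≤n
  ... | low = <-≤-trans (+-monoʳ-< (m + h) (<-≤-trans (∸-monoˡ-< x<k (block≡low⇒≥ bx)) l′≤l))
                        (≤-reflexive (m+[n∸m]≡n m+h≤n))

  block-stretch : ∀ x → block m h (stretch x) ≡ block m′ h′ x
  block-stretch x with block m′ h′ x in bx
  ... | mid = <⇒block≡mid (<-≤-trans (block≡mid⇒< bx) m′≤m)
  ... | high = ∈⇒block≡high (m≤m+n m _) (+-monoʳ-< m (<-≤-trans (block≡high⇒∸<h bx) h′≤h))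
  ... | low = ≥⇒block≡low (m≤m+n (m + h) _)

  stretch-mono : ∀ {x y} → x < y → stretch x < stretch y
  stretch-mono {x} {y} x<y with block m′ h′ x in bx | block m′ h′ y in by
  ... | mid | mid = x<y
  ... | mid | high = <-≤-trans (<-≤-trans (block≡mid⇒< bx) m′≤m) (m≤m+n m _)
  ... | mid | low = <-≤-trans (<-≤-trans (block≡mid⇒< bx) m′≤m) (≤-trans (m≤m+n m h) (m≤m+n (m + h) _))
  ... | high | high = +-monoʳ-< m (∸-monoˡ-< x<y (proj₁ (block≡high⇒∈ bx)))
  ... | high | low = <-≤-trans (+-monoʳ-< m (<-≤-trans (block≡high⇒∸<h bx) h′≤h)) (m≤m+n (m + h) _)
  ... | low | low = +-monoʳ-< (m + h) (∸-monoˡ-< x<y (block≡low⇒≥ bx))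
  ... | high | mid = ⊥-elim (≤⇒≯ (proj₁ (block≡high⇒∈ bx)) (<-trans x<y (block≡mid⇒< by)))
  ... | low | mid = ⊥-elim (≤⇒≯ (≤-trans (m≤m+n m′ h′) (block≡low⇒≥ bx)) (<-trans x<y (block≡mid⇒< by)))
  ... | low | high = ⊥-elim (≤⇒≯ (block≡low⇒≥ bx) (<-trans x<y (proj₂ (block≡high⇒∈ by))))

  stretch-cancel-< : ∀ {x y} → stretch x < stretch y → x < y
  stretch-cancel-< {x} {y} sx<sy with <-cmp x y
  ... | tri< x<y _ _ = x<y
  ... | tri≈ _ refl _ = ⊥-elim (<-irrefl refl sx<sy)
  ... | tri> _ _ y<x = ⊥-elim (<-asym sx<sy (stretch-mono y<x))

  BelowIn-stretch : ∀ B C x y → BelowIn B C x y ⇔ BelowIn B C (stretch x) (stretch y)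
  BelowIn-stretch mid mid x y = mk⇔ stretch-mono stretch-cancel-<
  BelowIn-stretch high high x y = mk⇔ stretch-mono stretch-cancel-<
  BelowIn-stretch low low x y = mk⇔ stretch-mono stretch-cancel-<
  BelowIn-stretch mid high x y = mk⇔ _ _
  BelowIn-stretch mid low x y = mk⇔ (λ ()) (λ ())
  BelowIn-stretch high mid x y = mk⇔ (λ ()) (λ ())
  BelowIn-stretch high low x y = mk⇔ (λ ()) (λ ())
  BelowIn-stretch low mid x y = mk⇔ _ _
  BelowIn-stretch low high x y = mk⇔ _ _

  Below-stretch : ∀ x y → Below m′ h′ x y ⇔ Below m h (stretch x) (stretch y)
  Below-stretch x y = subst₂ (λ B C → Below m′ h′ x y ⇔ BelowIn B C (stretch x) (stretch y))
    (sym (block-stretch x)) (sym (block-stretch y)) (BelowIn-stretch (block m′ h′ x) (block m′ h′ y) x y)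

HasShape-≼ : ∀ {k n m′ h′ m h} {p : Word k} {s : Word n} → HasShape m′ h′ p → HasShape m h s →
  m + h ≤ n → m′ ≤ m → h′ ≤ h → k ∸ (m′ + h′) ≤ n ∸ (m + h) → p ≼ s
HasShape-≼ {k} {n} {m′} {h′} {m} {h} {p} {s} p-shaped s-shaped m+h≤n m′≤m h′≤h l′≤l = e , increasing , sameOrder
  where
  open Stretch {k} m+h≤n m′≤m h′≤h l′≤l
  e : Fin k → Fin n
  e i = fromℕ< (stretch<n (Finₚ.toℕ<n i))
  toℕ-e : ∀ i → toℕ (e i) ≡ stretch (toℕ i)
  toℕ-e i = Finₚ.toℕ-fromℕ< _
  increasing : ∀ i j → i <ᶠ j → e i <ᶠ e j
  increasing i j i<j = subst₂ _<_ (sym (toℕ-e i)) (sym (toℕ-e j)) (stretch-mono i<j)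
  Below-e : ∀ i j → Below m′ h′ (toℕ i) (toℕ j) ⇔ Below m h (toℕ (e i)) (toℕ (e j))
  Below-e i j = subst₂ (λ a b → Below m′ h′ (toℕ i) (toℕ j) ⇔ Below m h a b) (sym (toℕ-e i)) (sym (toℕ-e j))
                  (Below-stretch (toℕ i) (toℕ j))
  sameOrder : ∀ i j → (lookup p i <ᶠ lookup p j) ⇔ (lookup s (e i) <ᶠ lookup s (e j))
  sameOrder i j = mk⇔
    (from (HasShape⇒<⇔Below s-shaped (e i) (e j)) ∘ to (Below-e i j) ∘ to (HasShape⇒<⇔Below p-shaped i j))
    (from (HasShape⇒<⇔Below p-shaped i j) ∘ from (Below-e i j) ∘ to (HasShape⇒<⇔Below s-shaped (e i) (e j)))

-- An embedding of a shape with non-empty first and second runs sends each run into the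
-- corresponding run: the ascents of the pattern must become ascents from the first run to the second.
module Runs {k n a d m h : ℕ} {p : Word k} {s : Word n}
            (p-shaped : HasShape (suc a) (suc d) p) (s-shaped : HasShape m h s) (fits : suc a + suc d ≤ k)
            (e : Fin k → Fin n) (increasing : ∀ i j → i <ᶠ j → e i <ᶠ e j)
            (sameOrder : ∀ i j → (lookup p i <ᶠ lookup p j) ⇔ (lookup s (e i) <ᶠ lookup s (e j))) where

  m′ h′ : ℕ
  m′ = suc a
  h′ = suc d

  ê : ℕ → ℕ
  ê = at e

  ê-mono : ∀ {x y} → x < y → y < k → ê x < ê y
  ê-mono {x} {y} x<y y<k = subst₂ _<_ (sym (at-fromℕ< e x<k)) (sym (at-fromℕ< e y<k))
    (increasing _ _ (fromℕ<-mono x<k y<k x<y))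
    where
    x<k : x < k
    x<k = <-trans x<y y<k

  ê<n : ∀ {x} → x < k → ê x < n
  ê<n x<k = subst (_< n) (sym (at-fromℕ< e x<k)) (Finₚ.toℕ<n _)

  ê-+ : ∀ x r → x + r < k → ê x + r ≤ ê (x + r)
  ê-+ x zero _ = ≤-reflexive (trans (+-identityʳ (ê x)) (cong ê (sym (+-identityʳ x))))
  ê-+ x (suc r) x+1+r<k = begin
    ê x + suc r        ≡⟨ +-suc (ê x) r ⟩
    suc (ê x + r)      ≤⟨ s≤s (ê-+ x r (<-trans (m<m+n (x + r) (s≤s z≤n)) x+r+1<k)) ⟩
    suc (ê (x + r))    ≤⟨ ê-mono (m<m+n (x + r) (s≤s z≤n)) x+r+1<k ⟩
    ê (x + r + 1)      ≡⟨ cong ê (trans (+-assoc x r 1) (cong (x +_) (+-comm r 1))) ⟩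
    ê (x + suc r)      ∎
    where
    open ≤-Reasoning
    x+r+1<k : x + r + 1 < k
    x+r+1<k = subst (_< k) (sym (trans (+-assoc x r 1) (cong (x +_) (+-comm r 1)))) x+1+r<k

  x≤ê : ∀ {x} → x < k → x ≤ ê x
  x≤ê {x} x<k = ≤-trans (m≤n+m x (ê 0)) (ê-+ 0 x x<k)

  Below-ê : ∀ {x y} → x < k → y < k → Below m′ h′ x y → Below m h (ê x) (ê y)
  Below-ê {x} {y} x<k y<k below = subst₂ (Below m h) (sym (at-fromℕ< e x<k)) (sym (at-fromℕ< e y<k))
    (to (HasShape⇒<⇔Below s-shaped _ _) (to (sameOrder _ _) (below⇒< p-shaped _ _
      (subst₂ (Below m′ h′) (sym (Finₚ.toℕ-fromℕ< x<k)) (sym (Finₚ.toℕ-fromℕ< y<k)) below))))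

  ascent-ê : ∀ {x y} → x < y → y < k → Below m′ h′ x y → block m h (ê x) ≡ mid × block m h (ê y) ≡ high
  ascent-ê x<y y<k below = Below-ascent m h (ê-mono x<y y<k) (Below-ê (<-trans x<y y<k) y<k below)

  -- The positions a < m′ ≤ c < t: last of the first run, first and last of the second, first of the third.
  c t : ℕ
  c = m′ + d
  t = m′ + h′

  m′≤t : m′ ≤ t
  m′≤t = m≤m+n m′ h′

  c<t : c < t
  c<t = +-monoʳ-< m′ ≤-refl

  c<k : c < k
  c<k = <-≤-trans c<t fits

  a-first : block m′ h′ a ≡ mid
  a-first = <⇒block≡mid ≤-refl

  second : ∀ {x} → m′ ≤ x → x ≤ c → block m′ h′ x ≡ high
  second m′≤x x≤c = ∈⇒block≡high m′≤x (≤-<-trans x≤c c<t)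

  ascent-from-a : ∀ {x} → m′ ≤ x → x ≤ c → block m h (ê a) ≡ mid × block m h (ê x) ≡ high
  ascent-from-a m′≤x x≤c = ascent-ê m′≤x (≤-<-trans x≤c c<k)
    (subst₂ (λ B C → BelowIn B C a _) (sym a-first) (sym (second m′≤x x≤c)) tt)

  m′≤m : m′ ≤ m
  m′≤m = ≤-<-trans (x≤ê (<-≤-trans (n<1+n a) (≤-trans m′≤t fits)))
                   (block≡mid⇒< (proj₁ (ascent-from-a ≤-refl (m≤m+n m′ d))))

  m≤ê-m′ : m ≤ ê m′
  m≤ê-m′ = proj₁ (block≡high⇒∈ (proj₂ (ascent-from-a ≤-refl (m≤m+n m′ d))))

  h′≤h : h′ ≤ h
  h′≤h = +-cancelˡ-< m d h (begin-strict
    m + d       ≤⟨ +-monoˡ-≤ d m≤ê-m′ ⟩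
    ê m′ + d    ≤⟨ ê-+ m′ d c<k ⟩
    ê c         <⟨ proj₂ (block≡high⇒∈ (proj₂ (ascent-from-a (m≤m+n m′ d) ≤-refl))) ⟩
    m + h       ∎)
    where open ≤-Reasoning

  -- The first entry of the third run lies below the first run, so its image lies in the third run.
  t-third : t < k → block m h (ê t) ≡ low
  t-third t<k with block m h (ê t) in bt
  ... | mid = ⊥-elim (≤⇒≯ m≤ê-m′ (<-trans (ê-mono (m<m+n m′ (s≤s z≤n)) t<k) (block≡mid⇒< bt)))
  ... | low = refl
  ... | high = ⊥-elim (subst (λ B → BelowIn B mid (ê t) (ê a)) bt
    (subst (λ C → BelowIn (block m h (ê t)) C (ê t) (ê a)) (proj₁ (ascent-from-a ≤-refl (m≤m+n m′ d)))
      (Below-ê t<k (<-≤-trans (n<1+n a) (≤-trans m′≤t fits))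
        (subst₂ (λ B C → BelowIn B C t a) (sym (≥⇒block≡low ≤-refl)) (sym a-first) tt))))

  l′≤l : k ∸ t ≤ n ∸ (m + h)
  l′≤l with k ∸ t in k∸t≡l′
  ... | zero = z≤n
  ... | suc r = m+n≤o⇒m≤o∸n (suc r) (begin
    suc r + (m + h)   ≡⟨ +-comm (suc r) (m + h) ⟩
    m + h + suc r     ≡⟨ +-suc (m + h) r ⟩
    suc (m + h + r)   ≤⟨ s≤s (+-monoˡ-≤ r (block≡low⇒≥ (t-third t<k))) ⟩
    suc (ê t + r)     ≤⟨ s≤s (ê-+ t r t+r<k) ⟩
    suc (ê (t + r))   ≤⟨ ê<n t+r<k ⟩
    n                 ∎)
    where
    open ≤-Reasoning
    k≡t+1+r : k ≡ t + suc r
    k≡t+1+r = trans (sym (m+[n∸m]≡n fits)) (cong (t +_) k∸t≡l′)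
    t+r<k : t + r < k
    t+r<k = subst (t + r <_) (sym k≡t+1+r) (subst (t + r <_) (sym (+-suc t r)) ≤-refl)
    t<k : t < k
    t<k = ≤-<-trans (m≤m+n t r) t+r<k

≼⇒shape≤ : ∀ {k n m′ h′ m h} {p : Word k} {s : Word n} → HasShape m′ h′ p → HasShape m h s →
  m′ + h′ ≤ k → 0 < m′ → 0 < h′ → p ≼ s → m′ ≤ m × h′ ≤ h × k ∸ (m′ + h′) ≤ n ∸ (m + h)
≼⇒shape≤ {m′ = suc a} {suc d} p-shaped s-shaped fits _ _ (e , increasing , sameOrder) =
  m′≤m , h′≤h , l′≤l
  where open Runs p-shaped s-shaped fits e increasing sameOrder

-- Decreasing permutations

Decreasing : ∀ {k} → Word k → Set
Decreasing {k} w = ∀ (i j : Fin k) → i <ᶠ j → lookup w j <ᶠ lookup w i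

Below-irrefl : ∀ m h x → ¬ Below m h x x
Below-irrefl m h x with block m h x
... | mid = <-irrefl refl
... | high = <-irrefl refl
... | low = <-irrefl refl

Decreasing? : ∀ {k} (w : Word k) → Dec (Decreasing w)
Decreasing? w = Finₚ.all? λ i → Finₚ.all? λ j → (i Finₚ.<? j) →-dec (lookup w j Finₚ.<? lookup w i)

-- Without a first or without a second run there is no ascent.
Degenerate-Below⇒> : ∀ {m h x y} → m ≡ 0 ⊎ h ≡ 0 → Below m h x y → y < x
Degenerate-Below⇒> {m} {h} {x} {y} degenerate below with <-cmp x y
... | tri> _ _ y<x = y<x
... | tri≈ _ refl _ = ⊥-elim (Below-irrefl m h x below)
... | tri< x<y _ _ with Below-ascent m h x<y below | degenerate
...   | x-mid , _ | inj₁ refl = ⊥-elim (n≮0 (block≡mid⇒< x-mid))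
...   | _ , y-high | inj₂ refl = ⊥-elim (n≮0 (block≡high⇒∸<h y-high))

HasShape⇒Decreasing : ∀ {k m h} {w : Word k} → m ≡ 0 ⊎ h ≡ 0 → HasShape m h w → Decreasing w
HasShape⇒Decreasing {m = m} {h} degenerate shaped i j i<j with Below-connex m h (λ eq → <-irrefl eq i<j)
... | inj₁ below-ij = ⊥-elim (<-asym i<j (Degenerate-Below⇒> degenerate below-ij))
... | inj₂ below-ji = below⇒< shaped j i below-ji

Decreasing⇒HasShape : ∀ {k m h} {w : Word k} → m ≡ 0 ⊎ h ≡ 0 → Decreasing w → HasShape m h w
Decreasing⇒HasShape degenerate decreasing = mkShape λ i j below → decreasing j i (Degenerate-Below⇒> degenerate below)

Decreasing-unique : ∀ {k} {w w′ : Word k} → Decreasing w → Decreasing w′ → w ≡ w′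
Decreasing-unique {w = w} {w′} decreasing decreasing′ = HasShape-unique {m = 0} {0}
  (Decreasing⇒HasShape {w = w} (inj₁ refl) decreasing) (Decreasing⇒HasShape {w = w′} (inj₁ refl) decreasing′)

Decreasing-≼ : ∀ {k n} {p : Word k} {s : Word n} → Decreasing s → p ≼ s → Decreasing p
Decreasing-≼ decreasing (e , increasing , sameOrder) i j i<j = from (sameOrder j i) (decreasing (e i) (e j) (increasing i j i<j))

decreasingPerm : ∀ n → Word n
decreasingPerm n = shapePerm n 0 0

decreasingPerm-HasShape : ∀ n → HasShape 0 0 (decreasingPerm n)
decreasingPerm-HasShape n = shapePerm-HasShape z≤n

decreasingPerm-Decreasing : ∀ n → Decreasing (decreasingPerm n)
decreasingPerm-Decreasing n = HasShape⇒Decreasing (inj₁ refl) (decreasingPerm-HasShape n)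

-- The runs of a permutation of shape (m, h) give decreasing subsequences of lengths m + l and h,
-- and in size k + k one of them has length at least k.
Decreasing-≼-InC : ∀ {k} {p : Word k} {σ : Word (k + k)} → Decreasing p → InC σ → p ≼ σ
Decreasing-≼-InC {k} {p} {σ} decreasing inC with InC⇒HasShape {σ = σ} inC
... | m , h , fits , shaped = longRun (k ≤? m) (k ≤? h)
  where
  l : ℕ
  l = k + k ∸ (m + h)
  embed : ∀ {m′ h′} → m′ ≡ 0 ⊎ h′ ≡ 0 → m′ ≤ m → h′ ≤ h → k ∸ (m′ + h′) ≤ l → p ≼ σ
  embed {m′} {h′} degenerate = HasShape-≼ (Decreasing⇒HasShape {m = m′} {h′} {w = p} degenerate decreasing) shaped fits
  k≤m+l : h < k → k ≤ m + l
  k≤m+l h<k = ≮⇒≥ λ m+l<k → <-irrefl (m+[n∸m]≡n fits) (subst (_< k + k) m+l+h≡m+h+l (+-mono-< m+l<k h<k))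
    where
    m+l+h≡m+h+l : m + l + h ≡ m + h + l
    m+l+h≡m+h+l = trans (+-assoc m l h) (trans (cong (m +_) (+-comm l h)) (sym (+-assoc m h l)))
  longRun : Dec (k ≤ m) → Dec (k ≤ h) → p ≼ σ
  longRun (yes k≤m) _ = embed (inj₂ refl) k≤m z≤n (≤-trans (≤-reflexive (m≤n⇒m∸n≡0 (m≤m+n k 0))) z≤n)
  longRun (no _) (yes k≤h) = embed (inj₁ refl) z≤n k≤h (≤-trans (≤-reflexive (n∸n≡0 k)) z≤n)
  longRun (no _) (no k≰h) = embed (inj₂ refl) ≤-refl z≤n
    (m≤n+o⇒m∸n≤o k (m + 0) (subst (λ x → k ≤ x + l) (sym (+-identityʳ m)) (k≤m+l (≰⇒> k≰h))))

ContC : ∀ {k} → Word k → Class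
ContC p s = InC s × p ≼ s

ContC? : ∀ {k} (p : Word k) {n} (w : Word n) → Dec (ContC p w)
ContC? p w = InC? w ×-dec p ≼? w

Enumerates-length-≤ : ∀ {X Y : Class} {n L M} → (∀ (w : Word n) → X w → Y w) →
  Enumerates X n L → Enumerates Y n M → length L ≤ length M
Enumerates-length-≤ X⊆Y (unique , L⇔X) (_ , M⇔Y) =
  Unique-⊆⇒length-≤ unique λ {w} w∈L → from (M⇔Y w) (X⊆Y w (to (L⇔X w) w∈L))

length-InC≡length-AvC+length-ContC : ∀ π {n K L D} → Enumerates InC n K → Enumerates (AvC π) n L →
  Enumerates (ContC (word π)) n D → length K ≡ length L + length D
length-InC≡length-AvC+length-ContC π {n} {K} {L} {D} (uK , K⇔) (uL , L⇔) (uD , D⇔) =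
  trans (≤-antisym (Unique-⊆⇒length-≤ uK K⊆L++D) (Unique-⊆⇒length-≤ uL++D L++D⊆K)) (Listₚ.length-++ L)
  where
  uL++D : Unique (L ++ D)
  uL++D = Uniqueₚ.++⁺ uL uD λ { {w} (w∈L , w∈D) → proj₂ (to (L⇔ w) w∈L) (proj₂ (to (D⇔ w) w∈D)) }
  K⊆L++D : ∀ {w} → w ∈ K → w ∈ L ++ D
  K⊆L++D {w} w∈K with word π ≼? w
  ... | yes π≼w = ∈-++⁺ʳ L (from (D⇔ w) (to (K⇔ w) w∈K , π≼w))
  ... | no π⋠w = ∈-++⁺ˡ (from (L⇔ w) (to (K⇔ w) w∈K , π⋠w))
  L++D⊆K : ∀ {w} → w ∈ L ++ D → w ∈ K
  L++D⊆K {w} w∈L++D with ∈-++⁻ L w∈L++D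
  ... | inj₁ w∈L = from (K⇔ w) (proj₁ (to (L⇔ w) w∈L))
  ... | inj₂ w∈D = from (K⇔ w) (proj₁ (to (D⇔ w) w∈D))

regroup₁ : ∀ A B D m h l → A + B + D + (m + h + l) ≡ (m + A) + (h + B) + (l + D)
regroup₁ = solve-∀

regroup₂ : ∀ A m B h l D → (A + m) + (B + h) + (l + D) ≡ A + B + D + (m + h + l)
regroup₂ = solve-∀

-- Run lengths (m, h, l) dominating (m₁, h₁, l₁) are shifted to (m, h, l) − (m₁, h₁, l₁) + (m₂, h₂, l₂).
shiftedShape-fits : ∀ {k n m₁ h₁ m₂ h₂ m h} → m₁ + h₁ ≤ k → m₂ + h₂ ≤ k → m + h ≤ n → m₁ ≤ m → h₁ ≤ h →
  k ∸ (m₁ + h₁) ≤ n ∸ (m + h) →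
  (m ∸ m₁ + m₂) + (h ∸ h₁ + h₂) ≤ n × k ∸ (m₂ + h₂) ≤ n ∸ ((m ∸ m₁ + m₂) + (h ∸ h₁ + h₂))
shiftedShape-fits {k} {n} {m₁} {h₁} {m₂} {h₂} {m} {h} fits₁ fits₂ fits m₁≤m h₁≤h l₁≤l = M+H≤n , l₂≤n∸[M+H]
  where
  A B l l₁ l₂ D M H : ℕ
  A = m ∸ m₁
  B = h ∸ h₁
  l = n ∸ (m + h)
  l₁ = k ∸ (m₁ + h₁)
  l₂ = k ∸ (m₂ + h₂)
  D = l ∸ l₁
  M = A + m₂
  H = B + h₂
  total : M + H + (l₂ + D) ≡ n
  total = begin
    M + H + (l₂ + D)                   ≡⟨ regroup₂ A m₂ B h₂ l₂ D ⟩
    A + B + D + (m₂ + h₂ + l₂)         ≡⟨ cong (A + B + D +_) (trans (m+[n∸m]≡n fits₂) (sym (m+[n∸m]≡n fits₁))) ⟩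
    A + B + D + (m₁ + h₁ + l₁)         ≡⟨ regroup₁ A B D m₁ h₁ l₁ ⟩
    (m₁ + A) + (h₁ + B) + (l₁ + D)     ≡⟨ cong₂ _+_ (cong₂ _+_ (m+[n∸m]≡n m₁≤m) (m+[n∸m]≡n h₁≤h))
                                                    (m+[n∸m]≡n l₁≤l) ⟩
    m + h + l                          ≡⟨ m+[n∸m]≡n fits ⟩
    n                                  ∎
    where open ≡-Reasoning
  M+H≤n : M + H ≤ n
  M+H≤n = subst (M + H ≤_) total (m≤m+n (M + H) (l₂ + D))
  l₂≤n∸[M+H] : l₂ ≤ n ∸ (M + H)
  l₂≤n∸[M+H] = subst (l₂ ≤_) (trans (sym (m+n∸m≡n (M + H) (l₂ + D))) (cong (_∸ (M + H)) total)) (m≤m+n l₂ D)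

-- Containing p is a condition on the shape only: each run must be at least as long as p's.
-- Replacing the runs of p by those of q, keeping the excess lengths, injects ContC p into ContC q.
module Shift {k n m₁ h₁ m₂ h₂ : ℕ} {p q : Word k} (p-shaped : HasShape m₁ h₁ p) (q-shaped : HasShape m₂ h₂ q)
             (fits₁ : m₁ + h₁ ≤ k) (fits₂ : m₂ + h₂ ≤ k)
             (0<m₁ : 0 < m₁) (0<h₁ : 0 < h₁) (0<m₂ : 0 < m₂) (0<h₂ : 0 < h₂) where

  Shifted : Word n → Word n → Set
  Shifted σ σ′ = Σ ℕ λ m → Σ ℕ λ h → m₁ ≤ m × h₁ ≤ h × HasShape m h σ ×
    (m ∸ m₁ + m₂) + (h ∸ h₁ + h₂) ≤ n × σ′ ≡ shapePerm n (m ∸ m₁ + m₂) (h ∸ h₁ + h₂)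

  Shifted-injective : ∀ {σ σ₂ σ′} → Shifted σ σ′ → Shifted σ₂ σ′ → σ ≡ σ₂
  Shifted-injective (m , h , m₁≤m , h₁≤h , shaped , fits , refl) (m′ , h′ , m₁≤m′ , h₁≤h′ , shaped′ , fits′ , eq) =
    HasShape-unique shaped (subst₂ (λ a b → HasShape a b _) (sym m≡m′) (sym h≡h′) shaped′)
    where
    sameShape : m ∸ m₁ + m₂ ≡ m′ ∸ m₁ + m₂ × h ∸ h₁ + h₂ ≡ h′ ∸ h₁ + h₂
    sameShape = shapePerm-injective fits fits′ (<-≤-trans 0<m₂ (m≤n+m m₂ _)) (<-≤-trans 0<h₂ (m≤n+m h₂ _))
                                     (<-≤-trans 0<m₂ (m≤n+m m₂ _)) (<-≤-trans 0<h₂ (m≤n+m h₂ _)) eq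
    m≡m′ : m ≡ m′
    m≡m′ = ∸-cancelʳ-≡ m₁≤m m₁≤m′ (+-cancelʳ-≡ m₂ _ _ (proj₁ sameShape))
    h≡h′ : h ≡ h′
    h≡h′ = ∸-cancelʳ-≡ h₁≤h h₁≤h′ (+-cancelʳ-≡ h₂ _ _ (proj₂ sameShape))

  Shifted-total : ∀ {σ} → ContC p σ → ∃ λ σ′ → ContC q σ′ × Shifted σ σ′
  Shifted-total {σ} (inC , p≼σ) with InC⇒HasShape {σ = σ} inC
  ... | m , h , fits , shaped with ≼⇒shape≤ p-shaped shaped fits₁ 0<m₁ 0<h₁ p≼σ
  ... | m₁≤m , h₁≤h , l₁≤l with shiftedShape-fits fits₁ fits₂ fits m₁≤m h₁≤h l₁≤l
  ... | fits′ , l₂≤l′ = shapePerm n (m ∸ m₁ + m₂) (h ∸ h₁ + h₂) , (HasShape⇒InC shifted-shaped , q≼shifted) ,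
                        m , h , m₁≤m , h₁≤h , shaped , fits′ , refl
    where
    shifted-shaped : HasShape (m ∸ m₁ + m₂) (h ∸ h₁ + h₂) (shapePerm n (m ∸ m₁ + m₂) (h ∸ h₁ + h₂))
    shifted-shaped = shapePerm-HasShape fits′
    q≼shifted : q ≼ shapePerm n (m ∸ m₁ + m₂) (h ∸ h₁ + h₂)
    q≼shifted = HasShape-≼ q-shaped shifted-shaped fits′ (m≤n+m m₂ (m ∸ m₁)) (m≤n+m h₂ (h ∸ h₁)) l₂≤l′

  length-ContC-≤ : ∀ {Dp Dq} → Enumerates (ContC p) n Dp → Enumerates (ContC q) n Dq → length Dp ≤ length Dq
  length-ContC-≤ {Dp} {Dq} (uDp , Dp⇔) (_ , Dq⇔) = length-≤-by-injection Shifted Shifted-injective Dp Dq uDp image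
    where
    image : ∀ {σ} → σ ∈ Dp → ∃ λ σ′ → σ′ ∈ Dq × Shifted σ σ′
    image {σ} σ∈ = let (σ′ , inContC , shifted) = Shifted-total (to (Dp⇔ σ) σ∈) in σ′ , from (Dq⇔ σ′) inContC , shifted

WilfEquivalent-sym : ∀ {X Y : Class} → WilfEquivalent X Y → WilfEquivalent Y X
WilfEquivalent-sym wilf n L M eL eM = sym (wilf n M L eM eL)

-- At size |π| < |τ|, the class Av_𝒞(τ) is all of 𝒞 while Av_𝒞(π) misses π itself.
Wilf⇒¬size< : ∀ π τ → π ∈C → size π < size τ → ¬ WilfEquivalent (AvC π) (AvC τ)
Wilf⇒¬size< π τ π∈C |π|<|τ| wilf
  with enumerate (AvC π) (AvC? π) (size π) | enumerate (AvC τ) (AvC? τ) (size π)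
... | L , uL , L⇔ | M , uM , M⇔ = <-irrefl (wilf (size π) L M (uL , L⇔) (uM , M⇔)) (Unique-⊆⇒length-≤ uπ∷L π∷L⊆M)
  where
  avoids-τ : ∀ (w : Word (size π)) → ¬ (word τ ≼ w)
  avoids-τ w τ≼w = ≤⇒≯ (Finₚ.injective⇒≤ (≼-injective {p = word τ} {s = w} τ≼w)) |π|<|τ|
  uπ∷L : Unique (word π ∷ L)
  uπ∷L = All.tabulate (λ {w} w∈L π≡w → proj₂ (to (L⇔ w) w∈L) (subst (word π ≼_) π≡w (≼-refl {p = word π}))) ∷ uL
  π∷L⊆M : ∀ {w} → w ∈ word π ∷ L → w ∈ M
  π∷L⊆M (here refl) = from (M⇔ _) (π∈C , avoids-τ (word π))
  π∷L⊆M {w} (there w∈L) = from (M⇔ w) (proj₁ (to (L⇔ w) w∈L) , avoids-τ w)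

-- At size |π| + |π|, the class Av_𝒞(π) of a decreasing π is empty, while Av_𝒞(τ) contains the
-- decreasing permutation.
Wilf⇒Decreasing⇒Decreasing : ∀ π τ → WilfEquivalent (AvC π) (AvC τ) → StrictlyDecreasing π → StrictlyDecreasing τ
Wilf⇒Decreasing⇒Decreasing π τ wilf π-decreasing with Decreasing? (word τ)
... | yes τ-decreasing = τ-decreasing
... | no τ-not-decreasing
  with enumerate (AvC π) (AvC? π) (size π + size π) | enumerate (AvC τ) (AvC? τ) (size π + size π)
... | L , uL , L⇔ | M , uM , M⇔ = ⊥-elim (<-irrefl (wilf _ L M (uL , L⇔) (uM , M⇔)) (≤-<-trans #L≤0 (∈-length δ∈M)))
  where
  #L≤0 : length L ≤ 0
  #L≤0 = Unique-⊆⇒length-≤ {ys = []} uL λ {w} w∈L →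
    let (inC , π⋠w) = to (L⇔ w) w∈L in ⊥-elim (π⋠w (Decreasing-≼-InC {p = word π} {σ = w} π-decreasing inC))
  δ : Word (size π + size π)
  δ = decreasingPerm (size π + size π)
  δ∈M : δ ∈ M
  δ∈M = from (M⇔ δ) (HasShape⇒InC (decreasingPerm-HasShape _) ,
                     τ-not-decreasing ∘ Decreasing-≼ {p = word τ} {s = δ} (decreasingPerm-Decreasing _))

Wilf⇒size≡ : ∀ π τ → π ∈C → τ ∈C → WilfEquivalent (AvC π) (AvC τ) → size π ≡ size τ
Wilf⇒size≡ π τ π∈C τ∈C wilf with <-cmp (size π) (size τ)
... | tri< |π|<|τ| _ _ = ⊥-elim (Wilf⇒¬size< π τ π∈C |π|<|τ| wilf)
... | tri≈ _ |π|≡|τ| _ = |π|≡|τ|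
... | tri> _ _ |τ|<|π| = ⊥-elim (Wilf⇒¬size< τ π τ∈C |τ|<|π| (WilfEquivalent-sym wilf))

≐⇒WilfEquivalent : ∀ {X Y : Class} → (∀ {n} (w : Word n) → X w → Y w) → (∀ {n} (w : Word n) → Y w → X w) →
  WilfEquivalent X Y
≐⇒WilfEquivalent {X} {Y} X⊆Y Y⊆X n L M eL eM =
  ≤-antisym (Enumerates-length-≤ {X} {Y} X⊆Y eL eM) (Enumerates-length-≤ {Y} {X} Y⊆X eM eL)

HasShape-nonDecreasing⇒0< : ∀ {k m h} {w : Word k} → ¬ Decreasing w → HasShape m h w → 0 < m × 0 < h
HasShape-nonDecreasing⇒0< not-decreasing shaped =
  n≢0⇒n>0 (λ m≡0 → not-decreasing (HasShape⇒Decreasing (inj₁ m≡0) shaped)) ,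
  n≢0⇒n>0 (λ h≡0 → not-decreasing (HasShape⇒Decreasing (inj₂ h≡0) shaped))

-- |𝒞ₙ| = |Av_𝒞(p)ₙ| + |ContC p ∩ 𝒞ₙ|, and the last term is the same for p and q.
nonDecreasing⇒Wilf : ∀ {k} {p q : Word k} (p-perm : IsPerm p) (q-perm : IsPerm q) → InC p → InC q →
  ¬ Decreasing p → ¬ Decreasing q → WilfEquivalent (AvC (mkPerm k p p-perm)) (AvC (mkPerm k q q-perm))
nonDecreasing⇒Wilf {k} {p} {q} p-perm q-perm p∈C q∈C p-not-decreasing q-not-decreasing n L M eL eM
  with InC⇒HasShape {σ = p} p∈C | InC⇒HasShape {σ = q} q∈C
... | m₁ , h₁ , fits₁ , p-shaped | m₂ , h₂ , fits₂ , q-shaped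
  with HasShape-nonDecreasing⇒0< p-not-decreasing p-shaped | HasShape-nonDecreasing⇒0< q-not-decreasing q-shaped
... | 0<m₁ , 0<h₁ | 0<m₂ , 0<h₂
  with enumerate InC InC? n | enumerate (ContC p) (ContC? p) n | enumerate (ContC q) (ContC? q) n
... | K , eK | Dp , eDp | Dq , eDq =
  +-cancelʳ-≡ (length Dp) (length L) (length M) (begin
    length L + length Dp  ≡⟨ length-InC≡length-AvC+length-ContC (mkPerm k p p-perm) eK eL eDp ⟨
    length K              ≡⟨ length-InC≡length-AvC+length-ContC (mkPerm k q q-perm) eK eM eDq ⟩
    length M + length Dq  ≡⟨ cong (length M +_) #Dp≡#Dq ⟨
    length M + length Dp  ∎)
  where
  open ≡-Reasoning
  #Dp≡#Dq : length Dp ≡ length Dq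
  #Dp≡#Dq = ≤-antisym (Shift.length-ContC-≤ p-shaped q-shaped fits₁ fits₂ 0<m₁ 0<h₁ 0<m₂ 0<h₂ eDp eDq)
                      (Shift.length-ContC-≤ q-shaped p-shaped fits₂ fits₁ 0<m₂ 0<h₂ 0<m₁ 0<h₁ eDq eDp)

sameSize⇒Wilf : ∀ π τ → π ∈C → τ ∈C → size π ≡ size τ → (StrictlyDecreasing π ⇔ StrictlyDecreasing τ) →
  WilfEquivalent (AvC π) (AvC τ)
sameSize⇒Wilf (mkPerm k p p-perm) (mkPerm .k q q-perm) p∈C q∈C refl sameDecreasing with Decreasing? p
... | yes p-decreasing =
  ≐⇒WilfEquivalent (λ w (inC , p⋠w) → inC , p⋠w ∘ subst (_≼ w) (sym p≡q))
                   (λ w (inC , q⋠w) → inC , q⋠w ∘ subst (_≼ w) p≡q)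
  where
  p≡q : p ≡ q
  p≡q = Decreasing-unique {w = p} {q} p-decreasing (to sameDecreasing p-decreasing)
... | no p-not-decreasing =
  nonDecreasing⇒Wilf {p = p} {q} p-perm q-perm p∈C q∈C p-not-decreasing (p-not-decreasing ∘ from sameDecreasing)

mainTheorem2 : (π τ : Perm) → π ∈C → τ ∈C →
    WilfEquivalent (AvC π) (AvC τ) ⇔
      (size π ≡ size τ × (StrictlyDecreasing π ⇔ StrictlyDecreasing τ))
mainTheorem2 π τ π∈C τ∈C = mk⇔
  (λ wilf → Wilf⇒size≡ π τ π∈C τ∈C wilf ,
            mk⇔ (Wilf⇒Decreasing⇒Decreasing π τ wilf) (Wilf⇒Decreasing⇒Decreasing τ π (WilfEquivalent-sym wilf)))
  (λ (|π|≡|τ| , sameDecreasing) → sameSize⇒Wilf π τ π∈C τ∈C |π|≡|τ| sameDecreasing)
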